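{- Let $A$ be a System T type, $d\in\mathcal{D}_{\mathbb N}\mathbb{N}$, $f_1:\mathbb{N}\to\mathcal{D}_{\mathbb N}\mathbb{N}$ and $f_2:\mathbb{N}\to[\![\mathsf{ChD}_A(\iota)]\!]$. If for all $n\in\mathbb{N}$ we have $\mathsf{enc}_A(f_1\,n)\approx_{\mathsf{ChD}_A(\iota)}f_2\,n$, then $\mathsf{enc}_A(f_1^\sharp\,d)\approx_{\mathsf{ChD}_A(\iota)}[\![K_A]\!]\,f_2\,(\mathsf{enc}_A\,d)$.
   Context: Metatheory: constructive Martin-Löf type theory without function extensionality. System T types: base $\iota$ and $\sigma\Rightarrow\tau$; standard terms and set interpretation $[\![\iota]\!]=\mathbb{N}$, $[\![\sigma\Rightarrow\tau]\!]=[\![\sigma]\!]\to[\![\tau]\!]$. Hereditarily extensional equality: $n\approx_\iota m$ iff $n=m$; $f\approx_{\sigma_1\Rightarrow\sigma_2}g$ iff $\forall x,y$, $x\approx_{\sigma_1}y\Rightarrow f\,x\approx_{\sigma_2}g\,y$. Dialogue trees $\mathcal{D}_{\mathbb N}\mathbb{N}$: inductive, constructors $\eta\,n$ and $\beta\,\varphi\,i$ ($\varphi:\mathbb{N}\to\mathcal{D}_{\mathbb N}\mathbb{N}$, $i\in\mathbb{N}$). Kleisli extension of $f:\mathbb{N}\to\mathcal{D}_{\mathbb N}\mathbb{N}$: $f^\sharp(\eta\,x)=f\,x$, $f^\sharp(\beta\,\varphi\,i)=\beta\,(\lambda o.f^\sharp(\varphi\,o))\,i$. Internal trees: $\mathsf{ChD}_A(\sigma):=(\sigma\Rightarrow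 A)\Rightarrow((\iota\Rightarrow A)\Rightarrow\iota\Rightarrow A)\Rightarrow A$; $\eta_A:=\lambda z\,e\,b.\,e\,z$; $\beta_A:=\lambda\varphi\,x\,e\,b.\,b\,(\lambda y.\varphi\,y\,e\,b)\,x$; $K_A:=\lambda f\,d\,e'\,b'.\,d\,(\lambda x.f\,x\,e'\,b')\,b'$, a closed term of type $(\iota\Rightarrow\mathsf{ChD}_A(\iota))\Rightarrow\mathsf{ChD}_A(\iota)\Rightarrow\mathsf{ChD}_A(\iota)$. Encoding $\mathsf{enc}_A:\mathcal{D}_{\mathbb N}\mathbb{N}\to[\![\mathsf{ChD}_A(\iota)]\!]$: $\mathsf{enc}_A(\eta\,z)=[\![\eta_A]\!]\,z$, $\mathsf{enc}_A(\beta\,\varphi\,x)=[\![\beta_A]\!]\,(\mathsf{enc}_A\circ\varphi)\,x$. -}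

module Defs where

open import Data.Nat using (ℕ; zero; suc)
open import Relation.Binary.PropositionalEquality using (_≡_)

data Ty : Set where
  ι   : Ty
  _⇒_ : Ty → Ty → Ty
infixr 30 _⇒_

⟦_⟧ : Ty → Set
⟦ ι ⟧     = ℕ
⟦ σ ⇒ τ ⟧ = ⟦ σ ⟧ → ⟦ τ ⟧

data Cxt : Set where
  ε   : Cxt
  _,,_ : Cxt → Ty → Cxt

data _∋_ : Cxt → Ty → Set where
  here  : ∀ {Γ σ} → (Γ ,, σ) ∋ σ
  there : ∀ {Γ σ τ} → Γ ∋ σ → (Γ ,, τ) ∋ σ

data T (Γ : Cxt) : Ty → Set where
  Zero : T Γ ι
  Succ : T Γ ι → T Γ ι
  Rec  : ∀ {σ} → T Γ (ι ⇒ σ ⇒ σ) → T Γ σ → T Γ ι → T Γ σ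
  ν    : ∀ {σ} → Γ ∋ σ → T Γ σ
  ƛ    : ∀ {σ τ} → T (Γ ,, σ) τ → T Γ (σ ⇒ τ)
  _·_  : ∀ {σ τ} → T Γ (σ ⇒ τ) → T Γ σ → T Γ τ
infixl 20 _·_

data Env : Cxt → Set where
  []  : Env ε
  _∷ᵉ_ : ∀ {Γ σ} → Env Γ → ⟦ σ ⟧ → Env (Γ ,, σ)

lookupᵉ : ∀ {Γ σ} → Env Γ → Γ ∋ σ → ⟦ σ ⟧
lookupᵉ (ρ ∷ᵉ x) here      = x
lookupᵉ (ρ ∷ᵉ x) (there i) = lookupᵉ ρ i

rec : ∀ {X : Set} → (ℕ → X → X) → X → ℕ → X
rec f x zero    = x
rec f x (suc n) = f n (rec f x n)

⟦_⟧ₑ : ∀ {Γ σ} → T Γ σ → Env Γ → ⟦ σ ⟧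
⟦ Zero ⟧ₑ ρ      = zero
⟦ Succ t ⟧ₑ ρ    = suc (⟦ t ⟧ₑ ρ)
⟦ Rec f x n ⟧ₑ ρ = rec (⟦ f ⟧ₑ ρ) (⟦ x ⟧ₑ ρ) (⟦ n ⟧ₑ ρ)
⟦ ν i ⟧ₑ ρ       = lookupᵉ ρ i
⟦ ƛ t ⟧ₑ ρ       = λ x → ⟦ t ⟧ₑ (ρ ∷ᵉ x)
⟦ t · u ⟧ₑ ρ     = ⟦ t ⟧ₑ ρ (⟦ u ⟧ₑ ρ)

⟦_⟧₀ : ∀ {σ} → T ε σ → ⟦ σ ⟧
⟦ t ⟧₀ = ⟦ t ⟧ₑ []

HEq : (σ : Ty) → ⟦ σ ⟧ → ⟦ σ ⟧ → Set
HEq ι n m = n ≡ m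
HEq (σ₁ ⇒ σ₂) f g = ∀ x y → HEq σ₁ x y → HEq σ₂ (f x) (g y)

data D : Set where
  η : ℕ → D
  β : (ℕ → D) → ℕ → D

_♯ : (ℕ → D) → D → D
(f ♯) (η x)   = f x
(f ♯) (β φ i) = β (λ o → (f ♯) (φ o)) i

ChD : Ty → Ty → Ty
ChD A σ = (σ ⇒ A) ⇒ ((ι ⇒ A) ⇒ ι ⇒ A) ⇒ A

v0 : ∀ {Γ σ} → (Γ ,, σ) ∋ σ
v0 = here
v1 : ∀ {Γ σ τ} → ((Γ ,, σ) ,, τ) ∋ σ
v1 = there here
v2 : ∀ {Γ σ τ ρ} → (((Γ ,, σ) ,, τ) ,, ρ) ∋ σ
v2 = there (there here)
v3 : ∀ {Γ σ τ ρ υ} → ((((Γ ,, σ) ,, τ) ,, ρ) ,, υ) ∋ σ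
v3 = there (there (there here))
v4 : ∀ {Γ σ τ ρ υ κ} → (((((Γ ,, σ) ,, τ) ,, ρ) ,, υ) ,, κ) ∋ σ
v4 = there (there (there (there here)))

-- η_A := λ z e b. e z
ηT : (A : Ty) → T ε (ι ⇒ ChD A ι)
ηT A = ƛ (ƛ (ƛ (ν v1 · ν v2)))

-- β_A := λ φ x e b. b (λ y. φ y e b) x
βT : (A : Ty) → T ε ((ι ⇒ ChD A ι) ⇒ ι ⇒ ChD A ι)
βT A = ƛ (ƛ (ƛ (ƛ (ν v0 · ƛ (ν v4 · ν v0 · ν v2 · ν v1) · ν v2))))

-- K_A := λ f d e' b'. d (λ x. f x e' b') b'
KT : (A : Ty) → T ε ((ι ⇒ ChD A ι) ⇒ ChD A ι ⇒ ChD A ι)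
KT A = ƛ (ƛ (ƛ (ƛ (ν v2 · ƛ (ν v4 · ν v0 · ν v2 · ν v1) · ν v0))))

enc : (A : Ty) → D → ⟦ ChD A ι ⟧
enc A (η z)   = ⟦ ηT A ⟧₀ z
enc A (β φ x) = ⟦ βT A ⟧₀ (λ o → enc A (φ o)) x

module Submission where

open import Defs
open import Data.Nat using (ℕ)
open import Relation.Binary.PropositionalEquality using (refl)

-- Both sides unfold definitionally: at a leaf η x to f₁ x and f₂ x, at a node β φ i
-- to the branching continuation applied to the subtrees, which are related by induction.
lemma30 : (A : Ty) (d : D) (f₁ : ℕ → D) (f₂ : ℕ → ⟦ ChD A ι ⟧)
    → (∀ n → HEq (ChD A ι) (enc A (f₁ n)) (f₂ n))
    → HEq (ChD A ι) (enc A ((f₁ ♯) d)) (⟦ KT A ⟧₀ f₂ (enc A d))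
lemma30 A (η x) f₁ f₂ f₁≈f₂ e e' e≈e' b b' b≈b' = f₁≈f₂ x e e' e≈e' b b' b≈b'
lemma30 A (β φ i) f₁ f₂ f₁≈f₂ e e' e≈e' b b' b≈b' =
  b≈b' _ _ (λ { y .y refl → lemma30 A (φ y) f₁ f₂ f₁≈f₂ e e' e≈e' b b' b≈b' }) i i refl
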